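{- Let $p$ be an odd prime with $p \equiv 2 \pmod 3$, and let $c \in \{1, -1\}$. For a positive integer $n$, let $M_n = [m_{ij}]_{1 \le i,j \le n}$ be the $n \times n$ matrix with entries $m_{ij} = \left[ \frac{j-i+c}{p} \right]$. Then for every $n$ with $1 < n \le p-1$, $\det(M_n) = 1$.
   Context: For an odd prime $p$ and an integer $a$, the cubic residue symbol is defined by $\left[ \frac{a}{p} \right] = 1$ if $a \not\equiv 0 \pmod p$ and $x^3 \equiv a \pmod p$ has an integer solution; $\left[ \frac{a}{p} \right] = -1$ if $x^3 \equiv a \pmod p$ has no integer solution; and $\left[ \frac{a}{p} \right] = 0$ if $a \equiv 0 \pmod p$. -}

module Defs where

open import Data.Nat as ℕ using (ℕ; zero; suc; NonZero; _^_; _%_)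
open import Data.Integer as ℤ using (ℤ; +_; 0ℤ; 1ℤ; -1ℤ; _%ℕ_)
open import Data.Fin using (Fin; zero; suc; toℕ; punchIn)
open import Data.Fin.Properties using (any?)
open import Data.Product using (∃)
open import Relation.Binary.PropositionalEquality using (_≡_)
open import Relation.Nullary using (does; yes; no)

-- "x^3 ≡ a (mod p) has an integer solution"; since x ↦ x^3 mod p only
-- depends on x mod p, it suffices to search x ∈ {0,…,p-1}.
-- Cubic residue symbol [a/p] as in the paper.
cubicSymbol : ℤ → (p : ℕ) → .{{NonZero p}} → ℤ
cubicSymbol a p with a %ℕ p ℕ.≟ 0
... | yes _ = 0ℤ
... | no _ with any? (λ (x : Fin p) → (toℕ x ^ 3) % p ℕ.≟ a %ℕ p)
...   | yes _ = 1ℤ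
...   | no _ = -1ℤ

Matrix : ℕ → Set
Matrix n = Fin n → Fin n → ℤ

minor : ∀ {n} → Matrix (suc n) → Fin (suc n) → Matrix n
minor M j r s = M (suc r) (punchIn j s)

altSum : ∀ {n} → (Fin n → ℤ) → ℤ
altSum {zero} f = 0ℤ
altSum {suc n} f = f zero ℤ.- altSum (λ j → f (suc j))

det : ∀ {n} → Matrix n → ℤ
det {zero} M = 1ℤ
det {suc n} M = altSum (λ j → M zero j ℤ.* det (minor M j))

module Submission where

-- Since gcd(3, p - 1) = 1, cubing is a bijection modulo p: the cube root of r
-- is r^e with 3e = 2p - 1, by Fermat's little theorem (FermatLittle, proved
-- from the binomial theorem of the standard library).  Hence [a/p] = 1 unless
-- p ∣ a, and as |j - i + c| < p the matrix is the all-ones matrix with zeros on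
-- the subdiagonal (c = 1) or the superdiagonal (c = -1) (CubicSymbol).
--
-- Differencing adjacent columns then reduces both
-- matrices to ones with an explicitly computable expansion.

module FermatLittle where

  open import Data.Nat
  open import Data.Nat.Properties
  open import Data.Nat.DivMod
  open import Data.Nat.Divisibility
  open import Data.Nat.Primality using (Prime; euclidsLemma; ¬prime[1])
  open import Data.Nat.Combinatorics using (_C_; nCn≡1; k![n∸k]!∣n!; nCk≡n!/k![n-k]!)
  open import Data.Fin using (Fin; zero; suc; toℕ; inject₁; fromℕ; fromℕ<)
  open import Data.Fin.Properties using (toℕ-inject₁; toℕ-fromℕ; toℕ-fromℕ<; toℕ<n)
  open import Data.Vec.Functional using (Vector; init; tail)
  open import Function using (_∘_)
  open import Data.Sum using (inj₁; inj₂)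
  open import Data.Product using (∃; _,_)
  open import Data.Nat.Tactic.RingSolver using (solve-∀)
  open import Data.Empty using (⊥-elim)
  open import Relation.Nullary using (¬_)
  open import Relation.Binary.PropositionalEquality
  import Algebra.Properties.CommutativeSemiring.Binomial +-*-commutativeSemiring as Binomial
  import Algebra.Definitions.RawSemiring +-*-rawSemiring as SemiringOps
  open import Algebra.Properties.Monoid.Sum +-0-monoid using (sum; sum-init-last)

  -- A prime does not divide m! when m < p: otherwise, by Euclid's lemma,
  -- it would divide one of the factors 1, …, m.
  prime∤factorial : ∀ {p} → Prime p → ∀ m → m < p → ¬ p ∣ m !
  prime∤factorial pr zero _ p∣1 = ¬prime[1] (subst Prime (∣1⇒≡1 p∣1) pr)
  prime∤factorial pr (suc m) m<p p∣m! with euclidsLemma (suc m) (m !) pr p∣m!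
  ... | inj₁ p∣1+m = <⇒≱ m<p (∣⇒≤ p∣1+m)
  ... | inj₂ p∣m!  = prime∤factorial pr m (<-trans (n<1+n m) m<p) p∣m!

  factorial-split : ∀ {n k} → k ≤ n → n ! ≡ (n C k) * (k ! * (n ∸ k) !)
  factorial-split {n} {k} k≤n = sym (begin
      (n C k) * (k ! * (n ∸ k) !)        ≡⟨ cong (_* (k ! * (n ∸ k) !)) (nCk≡n!/k![n-k]! k≤n) ⟩
      n ! / (k ! * (n ∸ k) !) * (k ! * (n ∸ k) !) ≡⟨ m/n*n≡m (k![n∸k]!∣n! k≤n) ⟩
      n !                                ∎)
    where
    open ≡-Reasoning
    instance _ = k !* (n ∸ k) !≢0

  -- The inner binomial coefficients of a prime are multiples of it:
  -- p ∣ p! = (p C k) · k! · (p ∸ k)!, and p divides neither factorial.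
  prime∣binomial : ∀ {p} → Prime p → ∀ k → 0 < k → k < p → p ∣ p C k
  prime∣binomial {suc p'} pr k 0<k k<p
    with euclidsLemma (suc p' C k) (k ! * (suc p' ∸ k) !) pr
           (subst (suc p' ∣_) (factorial-split (<⇒≤ k<p)) (m∣m*n (p' !)))
  ... | inj₁ p∣C = p∣C
  ... | inj₂ p∣factorials with euclidsLemma (k !) ((suc p' ∸ k) !) pr p∣factorials
  ...   | inj₁ p∣k! = ⊥-elim (prime∤factorial pr k k<p p∣k!)
  ...   | inj₂ p∣rest = ⊥-elim (prime∤factorial pr (suc p' ∸ k) (∸-monoʳ-< 0<k (<⇒≤ k<p)) p∣rest)

  ^-agrees : ∀ x n → x SemiringOps.^ n ≡ x ^ n
  ^-agrees x zero    = refl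
  ^-agrees x (suc n) = cong (x *_) (^-agrees x n)

  ×-agrees : ∀ n x → n SemiringOps.× x ≡ n * x
  ×-agrees zero    x = refl
  ×-agrees (suc n) x = cong (x +_) (×-agrees n x)

  ∣-sum : ∀ {d n} (t : Vector ℕ n) → (∀ i → d ∣ t i) → d ∣ sum t
  ∣-sum {n = zero}  t d∣t = _ ∣0
  ∣-sum {n = suc n} t d∣t = ∣m∣n⇒∣m+n (d∣t zero) (∣-sum (tail t) (d∣t ∘ suc))

  binomialTerm-value : ∀ x n (k : Fin (suc n)) →
    Binomial.binomialTerm 1 x n k ≡ (n C toℕ k) * x ^ (n ∸ toℕ k)
  binomialTerm-value x n k = begin
      (n C toℕ k) SemiringOps.× (1 SemiringOps.^ toℕ k * x SemiringOps.^ (n ∸ toℕ k))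
    ≡⟨ ×-agrees (n C toℕ k) _ ⟩
      (n C toℕ k) * (1 SemiringOps.^ toℕ k * x SemiringOps.^ (n ∸ toℕ k))
    ≡⟨ cong₂ (λ a b → (n C toℕ k) * (a * b)) (trans (^-agrees 1 (toℕ k)) (^-zeroˡ (toℕ k))) (^-agrees x (n ∸ toℕ k)) ⟩
      (n C toℕ k) * (1 * x ^ (n ∸ toℕ k))
    ≡⟨ cong ((n C toℕ k) *_) (*-identityˡ _) ⟩
      (n C toℕ k) * x ^ (n ∸ toℕ k) ∎
    where open ≡-Reasoning

  -- Freshman's dream: (1 + x)^p ≡ 1 + x^p (mod p).  In the binomial expansion
  -- the first term is x^p, the last is 1 and all others are multiples of p.
  freshman : ∀ {p} .{{_ : NonZero p}} → Prime p → ∀ x → (1 + x) ^ p % p ≡ (1 + x ^ p) % p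
  freshman {p@(suc p')} pr x = begin
      (1 + x) ^ p % p
    ≡⟨ cong (_% p) (trans (sym (^-agrees (1 + x) p)) (Binomial.theorem p 1 x)) ⟩
      sum t % p
    ≡⟨ cong (λ s → (t zero + s) % p) (sum-init-last (tail t)) ⟩
      (t zero + (sum (init (tail t)) + t (suc (fromℕ p')))) % p
    ≡⟨ cong₂ (λ a b → (a + (sum (init (tail t)) + b)) % p) first-term last-term ⟩
      (x ^ p + (sum (init (tail t)) + 1)) % p
    ≡⟨ cong (_% p) (rearrange (x ^ p) (sum (init (tail t)))) ⟩
      (sum (init (tail t)) + (1 + x ^ p)) % p
    ≡⟨ %-remove-+ˡ (1 + x ^ p) (∣-sum (init (tail t)) inner-term) ⟩
      (1 + x ^ p) % p ∎
    where
    open ≡-Reasoning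
    t = Binomial.binomialTerm 1 x p
    first-term : t zero ≡ x ^ p
    first-term = trans (binomialTerm-value x p zero) (+-identityʳ (x ^ p))
    last-term : t (suc (fromℕ p')) ≡ 1
    last-term = begin
        t (suc (fromℕ p'))
      ≡⟨ binomialTerm-value x p (suc (fromℕ p')) ⟩
        (p C suc (toℕ (fromℕ p'))) * x ^ (p' ∸ toℕ (fromℕ p'))
      ≡⟨ cong (λ k → (p C suc k) * x ^ (p' ∸ k)) (toℕ-fromℕ p') ⟩
        (p C p) * x ^ (p' ∸ p')
      ≡⟨ cong₂ (λ c e → c * x ^ e) (nCn≡1 p) (n∸n≡0 p') ⟩
        1 ∎
    inner-term : ∀ k → p ∣ t (suc (inject₁ k))
    inner-term k rewrite binomialTerm-value x p (suc (inject₁ k)) =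
      ∣m⇒∣m*n _ (prime∣binomial pr (suc (toℕ (inject₁ k))) z<s
                   (s<s (subst (_< p') (sym (toℕ-inject₁ k)) (toℕ<n k))))
    rearrange : ∀ a b → a + (b + 1) ≡ b + (1 + a)
    rearrange a b = trans (+-comm a (b + 1)) (+-assoc b 1 a)

  fermat : ∀ {p} .{{_ : NonZero p}} → Prime p → ∀ x → x ^ p % p ≡ x % p
  fermat {suc _} pr zero    = refl
  fermat {p} pr (suc x) = begin
      (1 + x) ^ p % p               ≡⟨ freshman pr x ⟩
      (1 + x ^ p) % p               ≡⟨ %-distribˡ-+ 1 (x ^ p) p ⟩
      (1 % p + x ^ p % p) % p       ≡⟨ cong (λ y → (1 % p + y) % p) (fermat pr x) ⟩
      (1 % p + x % p) % p           ≡⟨ %-distribˡ-+ 1 x p ⟨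
      (1 + x) % p                   ∎
    where open ≡-Reasoning

  %-pow : ∀ p .{{_ : NonZero p}} m k → (m % p) ^ k % p ≡ m ^ k % p
  %-pow p m zero    = refl
  %-pow p m (suc k) = begin
      (m % p * (m % p) ^ k) % p        ≡⟨ %-distribˡ-* (m % p) ((m % p) ^ k) p ⟩
      (m % p % p * ((m % p) ^ k % p)) % p ≡⟨ cong₂ (λ a b → (a * b) % p) (m%n%n≡m%n m p) (%-pow p m k) ⟩
      (m % p * (m ^ k % p)) % p        ≡⟨ %-distribˡ-* m (m ^ k) p ⟨
      (m * m ^ k) % p                  ∎
    where open ≡-Reasoning

  -- For p ≡ 2 (mod 3) the exponent e = 2⌊p/3⌋ + 1 = (2p - 1)/3 inverts cubing:
  -- 3e = p + (p - 1).
  cube-inverse-exponent : ∀ p' → suc p' % 3 ≡ 2 → suc (2 * (suc p' / 3)) * 3 ≡ suc p' + p'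
  cube-inverse-exponent p' p%3≡2 = begin
      suc (2 * q) * 3          ≡⟨ arithmetic q ⟩
      (2 + q * 3) + (1 + q * 3) ≡⟨ cong₂ _+_ p≡2+3q (suc-injective p≡2+3q) ⟨
      suc p' + p'              ∎
    where
    open ≡-Reasoning
    q = suc p' / 3
    p≡2+3q : suc p' ≡ 2 + q * 3
    p≡2+3q = trans (m≡m%n+[m/n]*n (suc p') 3) (cong (_+ q * 3) p%3≡2)
    arithmetic : ∀ q → suc (2 * q) * 3 ≡ (2 + q * 3) + (1 + q * 3)
    arithmetic = solve-∀

  CubeRoots : (p : ℕ) → .{{NonZero p}} → Set
  CubeRoots p = ∀ r → ∃ λ (x : Fin p) → (toℕ x ^ 3) % p ≡ r % p

  -- Every residue is a cube modulo a prime p ≡ 2 (mod 3): the root of r is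
  -- r^e, since r^(3e) = r^p · r^(p-1) ≡ r · r^(p-1) = r^p ≡ r by Fermat.
  everyResidueIsCube : ∀ {p} .{{_ : NonZero p}} → Prime p → p % 3 ≡ 2 → CubeRoots p
  everyResidueIsCube {p@(suc p')} pr p%3≡2 r = fromℕ< (m%n<n (r ^ e) p) , (begin
      toℕ (fromℕ< (m%n<n (r ^ e) p)) ^ 3 % p ≡⟨ cong (λ y → y ^ 3 % p) (toℕ-fromℕ< (m%n<n (r ^ e) p)) ⟩
      (r ^ e % p) ^ 3 % p                 ≡⟨ %-pow p (r ^ e) 3 ⟩
      (r ^ e) ^ 3 % p                     ≡⟨ cong (_% p) (^-*-assoc r e 3) ⟩
      r ^ (e * 3) % p                     ≡⟨ cong (λ k → r ^ k % p) (cube-inverse-exponent p' p%3≡2) ⟩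
      r ^ (p + p') % p                    ≡⟨ cong (_% p) (^-distribˡ-+-* r p p') ⟩
      (r ^ p * r ^ p') % p                ≡⟨ %-distribˡ-* (r ^ p) (r ^ p') p ⟩
      (r ^ p % p * (r ^ p' % p)) % p      ≡⟨ cong (λ y → (y * (r ^ p' % p)) % p) (fermat pr r) ⟩
      (r % p * (r ^ p' % p)) % p          ≡⟨ %-distribˡ-* r (r ^ p') p ⟨
      r ^ p % p                           ≡⟨ fermat pr r ⟩
      r % p                               ∎)
    where
    open ≡-Reasoning
    e = suc (2 * (p / 3))

module Determinants where

  open import Defs
  open import Data.Nat as ℕ using (ℕ; zero; suc; _<_; _≤_; z≤n; s≤s; z<s; s<s)
  import Data.Nat.Properties as ℕ
  open import Data.Integer using (ℤ; 0ℤ; 1ℤ; -1ℤ; _+_; _-_; _*_; -_)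
  import Data.Integer.Properties as ℤ
  open import Data.Integer.Tactic.RingSolver using (solve-∀)
  open import Data.Fin using (Fin; toℕ; punchIn) renaming (zero to fzero; suc to fsuc)
  open import Data.Product using (∃; _,_; _×_)
  open import Data.Sum using (_⊎_; inj₁; inj₂)
  open import Data.Bool using (true; false; if_then_else_)
  open import Data.Empty using (⊥-elim)
  open import Relation.Binary.PropositionalEquality
  open import Relation.Binary.Definitions using (tri<; tri≈; tri>)
  open import Relation.Nullary using (yes; no)
  open import Function using (_∘_)

  -- Matrices indexed by ℕ; a matrix of size n only uses entries below n.
  Mat : Set
  Mat = ℕ → ℕ → ℤ

  punch : ℕ → ℕ → ℕ
  punch zero    s       = suc s
  punch (suc j) zero    = zero
  punch (suc j) (suc s) = suc (punch j s)

  minorAt : Mat → ℕ → Mat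
  minorAt M j r s = M (suc r) (punch j s)

  alt : ℕ → (ℕ → ℤ) → ℤ
  alt zero    f = 0ℤ
  alt (suc n) f = f 0 - alt n (λ j → f (suc j))

  detℕ : ℕ → Mat → ℤ
  cofactor : ℕ → Mat → ℕ → ℤ

  detℕ zero    M = 1ℤ
  detℕ (suc n) M = alt (suc n) (cofactor n M)

  cofactor n M j = M 0 j * detℕ n (minorAt M j)

  toℕ-punchIn : ∀ {n} (j : Fin (suc n)) (s : Fin n) → toℕ (punchIn j s) ≡ punch (toℕ j) (toℕ s)
  toℕ-punchIn fzero    s        = refl
  toℕ-punchIn (fsuc j) fzero    = refl
  toℕ-punchIn (fsuc j) (fsuc s) = cong suc (toℕ-punchIn j s)

  altSum≡alt : ∀ n (f : Fin n → ℤ) g → (∀ j → f j ≡ g (toℕ j)) → altSum f ≡ alt n g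
  altSum≡alt zero    f g f≡g = refl
  altSum≡alt (suc n) f g f≡g =
    cong₂ _-_ (f≡g fzero) (altSum≡alt n (λ j → f (fsuc j)) (λ j → g (suc j)) (λ j → f≡g (fsuc j)))

  det≡detℕ : ∀ n (M : Matrix n) F → (∀ i j → M i j ≡ F (toℕ i) (toℕ j)) → det M ≡ detℕ n F
  det≡detℕ zero    M F M≡F = refl
  det≡detℕ (suc n) M F M≡F = altSum≡alt (suc n) _ (cofactor n F) λ j →
    cong₂ _*_ (M≡F fzero j) (det≡detℕ n (minor M j) (minorAt F (toℕ j))
      (λ r s → trans (M≡F (fsuc r) (punchIn j s)) (cong (F (suc (toℕ r))) (toℕ-punchIn j s))))

  punch-below : ∀ j s → s < j → punch j s ≡ s
  punch-below (suc j) zero    _         = refl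
  punch-below (suc j) (suc s) (s<s s<j) = cong suc (punch-below j s s<j)

  punch-above : ∀ j s → j ≤ s → punch j s ≡ suc s
  punch-above zero    s       _         = refl
  punch-above (suc j) (suc s) (s≤s j≤s) = cong suc (punch-above j s j≤s)

  punch-bound : ∀ n j s → s < n → punch j s < suc n
  punch-bound n       zero    s       s<n       = s<s s<n
  punch-bound (suc n) (suc j) zero    _         = z<s
  punch-bound (suc n) (suc j) (suc s) (s<s s<n) = s<s (punch-bound n j s s<n)

  punch-avoids : ∀ j s → punch j s ≢ j
  punch-avoids zero    s       ()
  punch-avoids (suc j) zero    ()
  punch-avoids (suc j) (suc s) eq = punch-avoids j s (ℕ.suc-injective eq)

  punch-injective : ∀ j s t → punch j s ≡ punch j t → s ≡ t
  punch-injective zero    s       t       eq = ℕ.suc-injective eq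
  punch-injective (suc j) zero    zero    eq = refl
  punch-injective (suc j) (suc s) (suc t) eq = cong suc (punch-injective j s t (ℕ.suc-injective eq))

  punch-onto : ∀ n j a → j < suc n → j ≢ a → a < suc n → ∃ λ s → s < n × punch j s ≡ a
  punch-onto n       zero    zero    _         j≢a _         = ⊥-elim (j≢a refl)
  punch-onto n       zero    (suc a) _         _   (s<s a<n) = a , a<n , refl
  punch-onto zero    (suc j) _       (s<s ())  _   _
  punch-onto (suc n) (suc j) zero    _         _   _         = zero , z<s , refl
  punch-onto (suc n) (suc j) (suc a) (s<s j<n) j≢a (s<s a<n)
    with punch-onto n j a j<n (λ j≡a → j≢a (cong suc j≡a)) a<n
  ... | s , s<n , eq = suc s , s<s s<n , cong suc eq

  punch-adjacent : ∀ a s → punch a s ≡ punch (suc a) s ⊎ (punch a s ≡ suc a × punch (suc a) s ≡ a)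
  punch-adjacent zero    zero    = inj₂ (refl , refl)
  punch-adjacent zero    (suc s) = inj₁ refl
  punch-adjacent (suc a) zero    = inj₁ refl
  punch-adjacent (suc a) (suc s) with punch-adjacent a s
  ... | inj₁ eq          = inj₁ (cong suc eq)
  ... | inj₂ (eq₁ , eq₂) = inj₂ (cong suc eq₁ , cong suc eq₂)

  sign : ℕ → ℤ
  sign zero    = 1ℤ
  sign (suc k) = - sign k

  alt-cong : ∀ n f g → (∀ j → j < n → f j ≡ g j) → alt n f ≡ alt n g
  alt-cong zero    f g f≡g = refl
  alt-cong (suc n) f g f≡g = cong₂ _-_ (f≡g 0 z<s) (alt-cong n _ _ (λ j j<n → f≡g (suc j) (s<s j<n)))

  alt-zero : ∀ n f → (∀ j → j < n → f j ≡ 0ℤ) → alt n f ≡ 0ℤ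
  alt-zero zero    f f≡0 = refl
  alt-zero (suc n) f f≡0 rewrite f≡0 0 z<s | alt-zero n (λ j → f (suc j)) (λ j j<n → f≡0 (suc j) (s<s j<n)) = refl

  alt-linear : ∀ n f g h t → (∀ j → j < n → f j ≡ g j + t * h j) → alt n f ≡ alt n g + t * alt n h
  alt-linear zero    f g h t _   = sym (trans (ℤ.+-identityˡ _) (ℤ.*-zeroʳ t))
  alt-linear (suc n) f g h t f≡ rewrite f≡ 0 z<s
    | alt-linear n (λ j → f (suc j)) (λ j → g (suc j)) (λ j → h (suc j)) t (λ j j<n → f≡ (suc j) (s<s j<n))
    = rearrange (g 0) (h 0) t (alt n (λ j → g (suc j))) (alt n (λ j → h (suc j)))
    where
    rearrange : ∀ a b t c d → a + t * b - (c + t * d) ≡ a - c + t * (b - d)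
    rearrange = solve-∀

  alt-single : ∀ n k f → k < n → (∀ j → j < n → j ≢ k → f j ≡ 0ℤ) → alt n f ≡ sign k * f k
  alt-single (suc n) zero    f _         f≡0
    rewrite alt-zero n (λ j → f (suc j)) (λ j j<n → f≡0 (suc j) (s<s j<n) λ ())
    = trans (ℤ.+-identityʳ (f 0)) (sym (ℤ.*-identityˡ (f 0)))
  alt-single (suc n) (suc k) f (s<s k<n) f≡0
    rewrite f≡0 0 z<s (λ ())
          | alt-single n k (λ j → f (suc j)) k<n (λ j j<n j≢k → f≡0 (suc j) (s<s j<n) (j≢k ∘ ℕ.suc-injective))
    = trans (ℤ.+-identityˡ _) (ℤ.neg-distribˡ-* (sign k) (f (suc k)))

  alt-pair : ∀ n a f → suc a < n → (∀ j → j < n → j ≢ a → j ≢ suc a → f j ≡ 0ℤ) →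
             f a ≡ f (suc a) → alt n f ≡ 0ℤ
  alt-pair (suc (suc n)) zero f _ f≡0 fa≡fa+1
    rewrite alt-zero n (λ j → f (suc (suc j))) (λ j j<n → f≡0 (suc (suc j)) (s<s (s<s j<n)) (λ ()) (λ ()))
          | fa≡fa+1
    = cancel (f 1)
    where
    cancel : ∀ x → x - (x - 0ℤ) ≡ 0ℤ
    cancel = solve-∀
  alt-pair (suc n) (suc a) f (s<s a+1<n) f≡0 fa≡fa+1
    rewrite f≡0 0 z<s (λ ()) (λ ())
          | alt-pair n a (λ j → f (suc j)) a+1<n
              (λ j j<n j≢a j≢a+1 → f≡0 (suc j) (s<s j<n) (j≢a ∘ ℕ.suc-injective) (j≢a+1 ∘ ℕ.suc-injective)) fa≡fa+1
    = refl

  detℕ-cong : ∀ n M N → (∀ i j → i < n → j < n → M i j ≡ N i j) → detℕ n M ≡ detℕ n N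
  detℕ-cong zero    M N M≡N = refl
  detℕ-cong (suc n) M N M≡N = alt-cong (suc n) _ _ λ j j<n →
    cong₂ _*_ (M≡N 0 j z<s j<n)
              (detℕ-cong n (minorAt M j) (minorAt N j) (λ r s r<n s<n → M≡N (suc r) (punch j s) (s<s r<n) (punch-bound n j s s<n)))

  -- The cofactor of the column a along which M = N + t·P is linear: the
  -- three minors coincide since they omit column a.
  cofactor-linear-at : ∀ n a M N P t →
    (∀ i j → j ≢ a → M i j ≡ N i j) → (∀ i j → j ≢ a → M i j ≡ P i j) →
    (∀ i → M i a ≡ N i a + t * P i a) → cofactor n M a ≡ cofactor n N a + t * cofactor n P a
  cofactor-linear-at n a M N P t M≡N M≡P Ma≡ = begin
      M 0 a * detℕ n (minorAt M a)                ≡⟨ cong₂ _*_ (Ma≡ 0) minorM≡minorN ⟩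
      (N 0 a + t * P 0 a) * detℕ n (minorAt N a)  ≡⟨ distribute (N 0 a) (P 0 a) t _ ⟩
      N 0 a * detℕ n (minorAt N a) + t * (P 0 a * detℕ n (minorAt N a))
        ≡⟨ cong (λ d → N 0 a * detℕ n (minorAt N a) + t * (P 0 a * d)) (trans (sym minorM≡minorN) minorM≡minorP) ⟩
      N 0 a * detℕ n (minorAt N a) + t * (P 0 a * detℕ n (minorAt P a)) ∎
    where
    open ≡-Reasoning
    minorM≡minorN = detℕ-cong n (minorAt M a) (minorAt N a) (λ r s _ _ → M≡N (suc r) (punch a s) (punch-avoids a s))
    minorM≡minorP = detℕ-cong n (minorAt M a) (minorAt P a) (λ r s _ _ → M≡P (suc r) (punch a s) (punch-avoids a s))
    distribute : ∀ x y t d → (x + t * y) * d ≡ x * d + t * (y * d)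
    distribute = solve-∀

  -- Linearity in column a: if M agrees with N and P off column a and
  -- column a of M is column a of N plus t times column a of P, then
  -- det M = det N + t · det P.  Every cofactor other than that of column a is
  -- linear by induction, column a reappearing in its minor.
  detℕ-linear : ∀ n a M N P t → a < n →
    (∀ i j → j ≢ a → M i j ≡ N i j) → (∀ i j → j ≢ a → M i j ≡ P i j) →
    (∀ i → M i a ≡ N i a + t * P i a) → detℕ n M ≡ detℕ n N + t * detℕ n P
  detℕ-linear (suc n) a M N P t a<n M≡N M≡P Ma≡ = alt-linear (suc n) (cofactor n M) (cofactor n N) (cofactor n P) t term
    where
    term : ∀ j → j < suc n → cofactor n M j ≡ cofactor n N j + t * cofactor n P j
    term j j<n with j ℕ.≟ a
    ... | yes refl = cofactor-linear-at n j M N P t M≡N M≡P Ma≡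
    ... | no j≢a with punch-onto n j a j<n j≢a a<n
    ...   | a′ , a′<n , punch≡a = begin
        M 0 j * detℕ n (minorAt M j)                         ≡⟨ cong (M 0 j *_) minor-linear ⟩
        M 0 j * (detℕ n (minorAt N j) + t * detℕ n (minorAt P j)) ≡⟨ distribute (M 0 j) _ _ t ⟩
        M 0 j * detℕ n (minorAt N j) + t * (M 0 j * detℕ n (minorAt P j))
          ≡⟨ cong₂ (λ x y → x * detℕ n (minorAt N j) + t * (y * detℕ n (minorAt P j))) (M≡N 0 j j≢a) (M≡P 0 j j≢a) ⟩
        N 0 j * detℕ n (minorAt N j) + t * (P 0 j * detℕ n (minorAt P j)) ∎
      where
      open ≡-Reasoning
      distribute : ∀ x d e t → x * (d + t * e) ≡ x * d + t * (x * e)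
      distribute = solve-∀
      off-a′ : ∀ s → s ≢ a′ → punch j s ≢ a
      off-a′ s s≢a′ eq = s≢a′ (punch-injective j s a′ (trans eq (sym punch≡a)))
      minor-linear = detℕ-linear n a′ (minorAt M j) (minorAt N j) (minorAt P j) t a′<n
        (λ r s s≢a′ → M≡N (suc r) (punch j s) (off-a′ s s≢a′))
        (λ r s s≢a′ → M≡P (suc r) (punch j s) (off-a′ s s≢a′))
        (λ r → subst (λ c → M (suc r) c ≡ N (suc r) c + t * P (suc r) c) (sym punch≡a) (Ma≡ (suc r)))

  -- A matrix with two equal adjacent columns a, a+1 has determinant 0.  The
  -- cofactors of columns a and a+1 cancel in the alternating sum (their minors
  -- coincide), and every other minor still has two equal adjacent columns.
  detℕ-adjacent : ∀ n a M → suc a < n → (∀ i → M i a ≡ M i (suc a)) → detℕ n M ≡ 0ℤ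
  detℕ-adjacent (suc n) a M a+1<n Ma≡Ma+1 =
    alt-pair (suc n) a (cofactor n M) a+1<n other-cofactor (cong₂ _*_ (Ma≡Ma+1 0) (detℕ-cong n _ _ λ r s _ _ → same-minor r s))
    where
    same-minor : ∀ r s → M (suc r) (punch a s) ≡ M (suc r) (punch (suc a) s)
    same-minor r s with punch-adjacent a s
    ... | inj₁ eq          = cong (M (suc r)) eq
    ... | inj₂ (eq₁ , eq₂) = trans (cong (M (suc r)) eq₁) (trans (sym (Ma≡Ma+1 (suc r))) (cong (M (suc r)) (sym eq₂)))
    minor-left-of : ∀ j a → j < a → suc a < suc n → (∀ i → M i a ≡ M i (suc a)) → detℕ n (minorAt M j) ≡ 0ℤ
    minor-left-of j (suc b) (s≤s j≤b) (s<s b+1<n) equal = detℕ-adjacent n b (minorAt M j) b+1<n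
      (λ r → trans (cong (M (suc r)) (punch-above j b j≤b))
             (trans (equal (suc r)) (cong (M (suc r)) (sym (punch-above j (suc b) (ℕ.m≤n⇒m≤1+n j≤b))))))
    other-minor : ∀ j → j < suc n → j ≢ a → j ≢ suc a → detℕ n (minorAt M j) ≡ 0ℤ
    other-minor j j<n j≢a j≢a+1 with ℕ.<-cmp j a
    ... | tri≈ _ j≡a _ = ⊥-elim (j≢a j≡a)
    ... | tri< j<a _ _ = minor-left-of j a j<a a+1<n Ma≡Ma+1
    ... | tri> _ _ a<j = detℕ-adjacent n a (minorAt M j) a+1<n′
        (λ r → trans (cong (M (suc r)) (punch-below j a a<j))
               (trans (Ma≡Ma+1 (suc r)) (cong (M (suc r)) (sym (punch-below j (suc a) a+1<j)))))
      where
      a+1<j : suc a < j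
      a+1<j = ℕ.≤∧≢⇒< a<j (j≢a+1 ∘ sym)
      a+1<n′ : suc a < n
      a+1<n′ = ℕ.<-≤-trans a+1<j (ℕ.s≤s⁻¹ j<n)
    other-cofactor : ∀ j → j < suc n → j ≢ a → j ≢ suc a → cofactor n M j ≡ 0ℤ
    other-cofactor j j<n j≢a j≢a+1 = trans (cong (M 0 j *_) (other-minor j j<n j≢a j≢a+1)) (ℤ.*-zeroʳ (M 0 j))

  ⟦_≠_⟧ : ℕ → ℕ → ℤ
  ⟦ k ≠ l ⟧ = if k ℕ.≡ᵇ l then 0ℤ else 1ℤ

  ≡ᵇ-refl : ∀ k → (k ℕ.≡ᵇ k) ≡ true
  ≡ᵇ-refl zero    = refl
  ≡ᵇ-refl (suc k) = ≡ᵇ-refl k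

  ≡ᵇ-distinct : ∀ {k l} → k ≢ l → (k ℕ.≡ᵇ l) ≡ false
  ≡ᵇ-distinct {zero}  {zero}  k≢l = ⊥-elim (k≢l refl)
  ≡ᵇ-distinct {zero}  {suc l} _   = refl
  ≡ᵇ-distinct {suc k} {zero}  _   = refl
  ≡ᵇ-distinct {suc k} {suc l} k≢l = ≡ᵇ-distinct (k≢l ∘ cong suc)

  <ᵇ-true : ∀ {j k} → j < k → (j ℕ.<ᵇ k) ≡ true
  <ᵇ-true {zero}  {suc k} _         = refl
  <ᵇ-true {suc j} {suc k} (s<s j<k) = <ᵇ-true j<k

  <ᵇ-false : ∀ {j k} → k ≤ j → (j ℕ.<ᵇ k) ≡ false
  <ᵇ-false {j}     {zero}  _         = refl
  <ᵇ-false {suc j} {suc k} (s≤s k≤j) = <ᵇ-false k≤j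

  <ᵇ-step : ∀ {j k} → j ≢ k → (j ℕ.<ᵇ suc k) ≡ (j ℕ.<ᵇ k)
  <ᵇ-step {zero}  {zero}  j≢k = ⊥-elim (j≢k refl)
  <ᵇ-step {zero}  {suc k} _   = refl
  <ᵇ-step {suc j} {zero}  _   = refl
  <ᵇ-step {suc j} {suc k} j≢k = <ᵇ-step (j≢k ∘ cong suc)

  copyColumn : Mat → ℕ → ℕ → Mat
  copyColumn M a b i j = if j ℕ.≡ᵇ a then M i b else M i j

  -- Adding t times an adjacent column b to column a preserves the
  -- determinant: by linearity the change is t · det (copyColumn M a b), and
  -- that matrix has two equal adjacent columns.
  detℕ-column-op : ∀ n a b M M′ t → a < n → b < n → (b ≡ suc a ⊎ a ≡ suc b) →
    (∀ i j → j ≢ a → M′ i j ≡ M i j) → (∀ i → M′ i a ≡ M i a + t * M i b) → detℕ n M′ ≡ detℕ n M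
  detℕ-column-op n a b M M′ t a<n b<n adjacent M′≡M M′a≡ = begin
      detℕ n M′                    ≡⟨ detℕ-linear n a M′ M P t a<n M′≡M (λ i j j≢a → trans (M′≡M i j j≢a) (sym (P-off i j j≢a)))
                                        (λ i → trans (M′a≡ i) (cong (λ x → M i a + t * x) (sym (P-at i)))) ⟩
      detℕ n M + t * detℕ n P      ≡⟨ cong (λ d → detℕ n M + t * d) (P-singular adjacent) ⟩
      detℕ n M + t * 0ℤ            ≡⟨ trans (cong (detℕ n M +_) (ℤ.*-zeroʳ t)) (ℤ.+-identityʳ _) ⟩
      detℕ n M                     ∎
    where
    open ≡-Reasoning
    P = copyColumn M a b
    P-at : ∀ i → P i a ≡ M i b
    P-at i rewrite ≡ᵇ-refl a = refl
    P-off : ∀ i j → j ≢ a → P i j ≡ M i j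
    P-off i j j≢a rewrite ≡ᵇ-distinct j≢a = refl
    P-singular : b ≡ suc a ⊎ a ≡ suc b → detℕ n P ≡ 0ℤ
    P-singular (inj₁ refl) = detℕ-adjacent n a P b<n (λ i → trans (P-at i) (sym (P-off i (suc a) ℕ.1+n≢n)))
    P-singular (inj₂ refl) = detℕ-adjacent n b P a<n (λ i → trans (P-off i b (ℕ.1+n≢n ∘ sym)) (sym (P-at i)))

  subtract : ∀ x y → x - y ≡ x + -1ℤ * y
  subtract = solve-∀

  differenceLeft : Mat → ℕ → Mat
  differenceLeft M k i j = if j ℕ.<ᵇ k then M i j - M i (suc j) else M i j

  -- Doing this one column at a time from the left (each step uses a still
  -- unmodified neighbour) shows that the determinant is unchanged.
  differenceLeft-det : ∀ n M k → k < n → detℕ n (differenceLeft M k) ≡ detℕ n M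
  differenceLeft-det n M zero    _   = refl
  differenceLeft-det n M (suc k) k+1<n = trans
    (detℕ-column-op n k (suc k) (differenceLeft M k) (differenceLeft M (suc k)) -1ℤ k<n k+1<n (inj₁ refl) off-k at-k)
    (differenceLeft-det n M k k<n)
    where
    k<n : k < n
    k<n = ℕ.<-trans (ℕ.n<1+n k) k+1<n
    off-k : ∀ i j → j ≢ k → differenceLeft M (suc k) i j ≡ differenceLeft M k i j
    off-k i j j≢k rewrite <ᵇ-step j≢k = refl
    at-k : ∀ i → differenceLeft M (suc k) i k ≡ differenceLeft M k i k + -1ℤ * differenceLeft M k i (suc k)
    at-k i rewrite <ᵇ-true (ℕ.n<1+n k) | <ᵇ-false (ℕ.≤-refl {k}) | <ᵇ-false (ℕ.n≤1+n k) = subtract (M i k) (M i (suc k))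

  differenceRight : Mat → ℕ → Mat
  differenceRight M k i j = if j ℕ.<ᵇ k then M i j else M i j - M i (ℕ.pred j)

  -- For k ≥ 1 this is again a sequence of adjacent column operations, now
  -- performed from the right; induction on the number d = n - k of columns changed.
  differenceRight-det : ∀ n M d k → 1 ≤ k → k ℕ.+ d ≡ n → detℕ n (differenceRight M k) ≡ detℕ n M
  differenceRight-det n M zero k _ k+0≡n = detℕ-cong n _ _ λ i j _ j<n → unchanged i j (subst (j <_) (sym k≡n) j<n)
    where
    k≡n : k ≡ n
    k≡n = trans (sym (ℕ.+-identityʳ k)) k+0≡n
    unchanged : ∀ i j → j < k → differenceRight M k i j ≡ M i j
    unchanged i j j<k rewrite <ᵇ-true j<k = refl
  differenceRight-det n M (suc d) (suc k) _ k+d≡n = trans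
    (detℕ-column-op n (suc k) k (differenceRight M (suc (suc k))) (differenceRight M (suc k)) -1ℤ
                    k+1<n (ℕ.<-trans (ℕ.n<1+n k) k+1<n) (inj₂ refl) off-k at-k)
    (differenceRight-det n M d (suc (suc k)) (s≤s z≤n) (trans (sym (ℕ.+-suc (suc k) d)) k+d≡n))
    where
    k+1<n : suc k < n
    k+1<n = subst (suc k <_) k+d≡n (ℕ.m<m+n (suc k) z<s)
    off-k : ∀ i j → j ≢ suc k → differenceRight M (suc k) i j ≡ differenceRight M (suc (suc k)) i j
    off-k i j j≢k rewrite <ᵇ-step j≢k = refl
    at-k : ∀ i → differenceRight M (suc k) i (suc k) ≡
                 differenceRight M (suc (suc k)) i (suc k) + -1ℤ * differenceRight M (suc (suc k)) i k
    at-k i rewrite <ᵇ-false (ℕ.≤-refl {suc k}) | <ᵇ-true (ℕ.n<1+n (suc k)) | <ᵇ-true (ℕ.m<n⇒m<1+n (ℕ.n<1+n k))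
      = subtract (M i (suc k)) (M i k)

  -- (-1)^m · (-1)^m = 1, in the shape produced by cofactor expansion.
  sign-squared : ∀ m → sign m * (1ℤ * sign m) ≡ 1ℤ
  sign-squared zero    = refl
  sign-squared (suc m) = trans (negate-twice (sign m)) (sign-squared m)
    where
    negate-twice : ∀ x → - x * (1ℤ * - x) ≡ x * (1ℤ * x)
    negate-twice = solve-∀

  -- The lower bidiagonal matrix with -1 on the diagonal and 1 below it; its
  -- first row is (-1, 0, …) and its first minor is itself.
  bidiagonal : Mat
  bidiagonal r s = ⟦ s ≠ r ⟧ - ⟦ suc s ≠ r ⟧

  det-bidiagonal : ∀ m → detℕ m bidiagonal ≡ sign m
  det-bidiagonal zero = refl
  det-bidiagonal (suc m)
    rewrite alt-zero m (λ j → cofactor m bidiagonal (suc j)) (λ j _ → refl) | det-bidiagonal m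
    = expand (sign m)
    where
    expand : ∀ x → -1ℤ * x - 0ℤ ≡ - x
    expand = solve-∀

  -- Differencing
  -- each column with its right neighbour leaves the first row (0, …, 0, 1) with
  -- the bidiagonal matrix as last minor, so det = (-1)^m · (-1)^m.
  onesExceptSubdiagonal : Mat
  onesExceptSubdiagonal i j = ⟦ suc j ≠ i ⟧

  det-onesExceptSubdiagonal : ∀ m → detℕ (suc m) onesExceptSubdiagonal ≡ 1ℤ
  det-onesExceptSubdiagonal m = begin
      detℕ (suc m) onesExceptSubdiagonal ≡⟨ differenceLeft-det (suc m) onesExceptSubdiagonal m (ℕ.n<1+n m) ⟨
      detℕ (suc m) D                     ≡⟨ alt-single (suc m) m (cofactor m D) (ℕ.n<1+n m) first-row-zero ⟩
      sign m * cofactor m D m            ≡⟨ cong (sign m *_) last-cofactor ⟩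
      sign m * (1ℤ * sign m)             ≡⟨ sign-squared m ⟩
      1ℤ                                 ∎
    where
    open ≡-Reasoning
    D = differenceLeft onesExceptSubdiagonal m
    first-row-zero : ∀ j → j < suc m → j ≢ m → cofactor m D j ≡ 0ℤ
    first-row-zero j j<m+1 j≢m rewrite <ᵇ-true (ℕ.≤∧≢⇒< (ℕ.s≤s⁻¹ j<m+1) j≢m) = refl
    last-minor : ∀ r s → r < m → s < m → minorAt D m r s ≡ bidiagonal r s
    last-minor r s _ s<m rewrite punch-below m s s<m | <ᵇ-true s<m = refl
    last-cofactor : cofactor m D m ≡ 1ℤ * sign m
    last-cofactor rewrite <ᵇ-false (ℕ.≤-refl {m}) = cong (1ℤ *_) (trans (detℕ-cong m _ _ last-minor) (det-bidiagonal m))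

  onesExceptSuperdiagonal : Mat
  onesExceptSuperdiagonal i j = ⟦ j ≠ suc i ⟧

  -- Its right differences (differenceRight … 1): column 0 is all ones and
  -- column j + 1 is e_{j-1} - e_j for the unit columns e (with e_{-1} = 0).
  differencedSuper : Mat
  differencedSuper i zero    = 1ℤ
  differencedSuper i (suc j) = ⟦ j ≠ i ⟧ - ⟦ j ≠ suc i ⟧

  -- Adding column 1 to column 0 and then column 2 to column 1 turns the first
  -- row into (0, 0, 1, 0, …) while the minor at column 2 is differencedSuper
  -- again, one size smaller.
  det-differencedSuper : ∀ m → detℕ (suc (suc m)) differencedSuper ≡ 1ℤ
  det-differencedSuper zero    = refl
  det-differencedSuper (suc m) = begin
      detℕ n differencedSuper
        ≡⟨ detℕ-column-op n 0 1 differencedSuper C₁ 1ℤ z<s (s<s z<s) (inj₁ refl) C₁-off C₁-at ⟨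
      detℕ n C₁
        ≡⟨ detℕ-column-op n 1 2 C₁ C₂ 1ℤ (s<s z<s) (s<s (s<s z<s)) (inj₁ refl) C₂-off C₂-at ⟨
      detℕ n C₂
        ≡⟨ alt-single n 2 (cofactor (suc (suc m)) C₂) (s<s (s<s z<s)) first-row-zero ⟩
      1ℤ * (1ℤ * detℕ (suc (suc m)) (minorAt C₂ 2)) ≡⟨ trans (ℤ.*-identityˡ _) (ℤ.*-identityˡ _) ⟩
      detℕ (suc (suc m)) (minorAt C₂ 2)    ≡⟨ detℕ-cong (suc (suc m)) _ _ minor-at-2 ⟩
      detℕ (suc (suc m)) differencedSuper  ≡⟨ det-differencedSuper m ⟩
      1ℤ                                   ∎
    where
    open ≡-Reasoning
    n = suc (suc (suc m))
    C₁ : Mat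
    C₁ i zero    = differencedSuper i 0 + differencedSuper i 1
    C₁ i (suc j) = differencedSuper i (suc j)
    C₁-off : ∀ i j → j ≢ 0 → C₁ i j ≡ differencedSuper i j
    C₁-off i zero    j≢0 = ⊥-elim (j≢0 refl)
    C₁-off i (suc j) _   = refl
    C₁-at : ∀ i → C₁ i 0 ≡ differencedSuper i 0 + 1ℤ * differencedSuper i 1
    C₁-at i = cong (differencedSuper i 0 +_) (sym (ℤ.*-identityˡ (differencedSuper i 1)))
    C₂ : Mat
    C₂ i 1 = C₁ i 1 + C₁ i 2
    C₂ i j = C₁ i j
    C₂-off : ∀ i j → j ≢ 1 → C₂ i j ≡ C₁ i j
    C₂-off i zero          _   = refl
    C₂-off i (suc zero)    j≢1 = ⊥-elim (j≢1 refl)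
    C₂-off i (suc (suc j)) _   = refl
    C₂-at : ∀ i → C₂ i 1 ≡ C₁ i 1 + 1ℤ * C₁ i 2
    C₂-at i = cong (C₁ i 1 +_) (sym (ℤ.*-identityˡ (C₁ i 2)))
    first-row-zero : ∀ j → j < n → j ≢ 2 → cofactor (suc (suc m)) C₂ j ≡ 0ℤ
    first-row-zero 0             _ _   = refl
    first-row-zero 1             _ _   = refl
    first-row-zero 2             _ j≢2 = ⊥-elim (j≢2 refl)
    first-row-zero (suc (suc (suc j))) _ _ = refl
    minor-at-2 : ∀ r s → r < suc (suc m) → s < suc (suc m) → minorAt C₂ 2 r s ≡ differencedSuper r s
    minor-at-2 r       0             _ _ = refl
    minor-at-2 zero    1             _ _ = refl
    minor-at-2 (suc r) 1             _ _ = refl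
    minor-at-2 r       (suc (suc s)) _ _ = refl

  det-onesExceptSuperdiagonal : ∀ m → detℕ (suc (suc m)) onesExceptSuperdiagonal ≡ 1ℤ
  det-onesExceptSuperdiagonal m = begin
      detℕ (suc (suc m)) onesExceptSuperdiagonal
        ≡⟨ differenceRight-det (suc (suc m)) onesExceptSuperdiagonal (suc m) 1 (s≤s z≤n) refl ⟨
      detℕ (suc (suc m)) (differenceRight onesExceptSuperdiagonal 1) ≡⟨ detℕ-cong (suc (suc m)) _ _ same ⟩
      detℕ (suc (suc m)) differencedSuper        ≡⟨ det-differencedSuper m ⟩
      1ℤ                                         ∎
    where
    open ≡-Reasoning
    same : ∀ i j → i < suc (suc m) → j < suc (suc m) → differenceRight onesExceptSuperdiagonal 1 i j ≡ differencedSuper i j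
    same i zero    _ _ = refl
    same i (suc j) _ _ = refl

module CubicSymbol where

  open import Defs
  open import Data.Nat as ℕ using (ℕ; suc; NonZero; _%_; _<_; _∸_)
  import Data.Nat.Properties as ℕ
  open import Data.Nat.DivMod using (m<n⇒m%n≡m)
  open import Data.Integer using (ℤ; +_; 0ℤ; 1ℤ; -1ℤ; _+_; _%ℕ_; _-_; -_)
  import Data.Integer.Properties as ℤ
  open import Data.Integer.DivMod using (n%ℕd<d)
  open import Data.Integer.Tactic.RingSolver using (solve-∀)
  open import Data.Fin using (Fin; toℕ)
  open import Data.Fin.Properties using (any?)
  open import Data.Product using (_,_)
  open import Data.Empty using (⊥-elim)
  open import Relation.Binary.PropositionalEquality
  open import Relation.Binary.Definitions using (tri<; tri≈; tri>)
  open import Relation.Nullary using (yes; no; ¬_)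
  open FermatLittle using (CubeRoots)
  open Determinants using (⟦_≠_⟧; ≡ᵇ-refl; ≡ᵇ-distinct)

  cubicSymbol-unit : ∀ a p .{{_ : NonZero p}} → CubeRoots p → ¬ a %ℕ p ≡ 0 → cubicSymbol a p ≡ 1ℤ
  cubicSymbol-unit a p roots a≢0 with a %ℕ p ℕ.≟ 0
  ... | yes a≡0 = ⊥-elim (a≢0 a≡0)
  ... | no _ with any? (λ (x : Fin p) → (toℕ x ℕ.^ 3) % p ℕ.≟ a %ℕ p)
  ...   | yes _ = refl
  ...   | no noRoot with roots (a %ℕ p)
  ...     | x , x³≡a = ⊥-elim (noRoot (x , trans x³≡a (m<n⇒m%n≡m (n%ℕd<d a p))))

  cubicSymbol-zero : ∀ a p .{{_ : NonZero p}} → a %ℕ p ≡ 0 → cubicSymbol a p ≡ 0ℤ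
  cubicSymbol-zero a p a≡0 with a %ℕ p ℕ.≟ 0
  ... | yes _ = refl
  ... | no a≢0 = ⊥-elim (a≢0 a≡0)

  positive-%ℕ : ∀ d p .{{_ : NonZero p}} → 0 < d → d < p → ¬ (+ d) %ℕ p ≡ 0
  positive-%ℕ (suc d) p _ d<p d≡0 with () ← trans (sym (m<n⇒m%n≡m d<p)) d≡0

  negative-%ℕ : ∀ d p .{{_ : NonZero p}} → 0 < d → d < p → ¬ (- + d) %ℕ p ≡ 0
  negative-%ℕ (suc d) p _ d<p -d≡0 with suc d % p | m<n⇒m%n≡m d<p
  ... | ℕ.zero | ()
  ... | suc r  | r≡d rewrite r≡d = ℕ.<⇒≱ d<p (ℕ.m∸n≡0⇒m≤n -d≡0)

  difference-%ℕ : ∀ k l p .{{_ : NonZero p}} → k < p → l < p → k ≢ l → ¬ (+ k - + l) %ℕ p ≡ 0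
  difference-%ℕ k l p k<p l<p k≢l with ℕ.<-cmp k l
  ... | tri≈ _ k≡l _ = ⊥-elim (k≢l k≡l)
  ... | tri> _ _ l<k rewrite ℤ.m-n≡m⊖n k l | ℤ.⊖-≥ (ℕ.<⇒≤ l<k) =
    positive-%ℕ (k ∸ l) p (ℕ.m<n⇒0<n∸m l<k) (ℕ.≤-<-trans (ℕ.m∸n≤m k l) k<p)
  ... | tri< k<l _ _ rewrite ℤ.m-n≡m⊖n k l | ℤ.⊖-< k<l =
    negative-%ℕ (l ∸ k) p (ℕ.m<n⇒0<n∸m k<l) (ℕ.≤-<-trans (ℕ.m∸n≤m l k) l<p)

  cubicSymbol-difference : ∀ k l p .{{_ : NonZero p}} → CubeRoots p → k < p → l < p →
                           cubicSymbol (+ k - + l) p ≡ ⟦ k ≠ l ⟧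
  cubicSymbol-difference k l p roots k<p l<p with k ℕ.≟ l
  ... | yes refl rewrite ≡ᵇ-refl k =
    cubicSymbol-zero (+ k - + k) p (trans (cong (_%ℕ p) (ℤ.+-inverseʳ (+ k))) (m<n⇒m%n≡m (ℕ.≤-<-trans ℕ.z≤n k<p)))
  ... | no k≢l rewrite ≡ᵇ-distinct k≢l = cubicSymbol-unit (+ k - + l) p roots (difference-%ℕ k l p k<p l<p k≢l)

  entry-plus : ∀ i j p .{{_ : NonZero p}} → CubeRoots p → i < p → suc j < p →
               cubicSymbol ((+ j - + i) + 1ℤ) p ≡ ⟦ suc j ≠ i ⟧
  entry-plus i j p roots i<p j+1<p =
    trans (cong (λ a → cubicSymbol a p) (shift (+ j) (+ i))) (cubicSymbol-difference (suc j) i p roots j+1<p i<p)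
    where
    shift : ∀ x y → (x - y) + 1ℤ ≡ (1ℤ + x) - y
    shift = solve-∀

  entry-minus : ∀ i j p .{{_ : NonZero p}} → CubeRoots p → suc i < p → j < p →
                cubicSymbol ((+ j - + i) + -1ℤ) p ≡ ⟦ j ≠ suc i ⟧
  entry-minus i j p roots i+1<p j<p =
    trans (cong (λ a → cubicSymbol a p) (shift (+ j) (+ i))) (cubicSymbol-difference j (suc i) p roots j<p i+1<p)
    where
    shift : ∀ x y → (x - y) + -1ℤ ≡ x - (1ℤ + y)
    shift = solve-∀

open import Defs
open import Data.Nat using (ℕ; NonZero; _%_; _<_; _≤_; _∸_)
open import Data.Nat.Primality using (Prime)
open import Data.Integer using (ℤ; +_; _+_; _-_; 1ℤ; -1ℤ)
open import Data.Fin using (toℕ)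
open import Data.Sum using (_⊎_)
open import Relation.Binary.PropositionalEquality using (_≡_)

import Data.Nat as ℕ
import Data.Nat.Properties as ℕ
open import Data.Nat.Primality using (¬prime[0])
open import Data.Fin.Properties using (toℕ<n)
open import Data.Sum using (inj₁; inj₂)
open import Data.Empty using (⊥-elim)
open import Relation.Binary.PropositionalEquality using (refl; trans)
open FermatLittle using (everyResidueIsCube)
open CubicSymbol using (entry-plus; entry-minus)
open Determinants
  using (det≡detℕ; onesExceptSubdiagonal; det-onesExceptSubdiagonal; onesExceptSuperdiagonal; det-onesExceptSuperdiagonal)

-- Indices satisfy i, j < n ≤ p - 1, so j + 1 and i + 1 are still residues and
-- the matrix is one of the two shift matrices.
theorem3p3 : (p : ℕ) → .{{_ : NonZero p}} → Prime p → p % 2 ≡ 1 → p % 3 ≡ 2 →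
    (c : ℤ) → (c ≡ 1ℤ ⊎ c ≡ -1ℤ) →
    (n : ℕ) → 1 < n → n ≤ p ∸ 1 →
    det {n} (λ i j → cubicSymbol ((+ toℕ j - + toℕ i) + c) p) ≡ 1ℤ
theorem3p3 ℕ.zero pr = ⊥-elim (¬prime[0] pr)
theorem3p3 p@(ℕ.suc _) pr _ p%3≡2 _ (inj₁ refl) n@(ℕ.suc m) _ n≤p-1 =
  trans (det≡detℕ n _ onesExceptSubdiagonal λ i j →
           entry-plus (toℕ i) (toℕ j) p roots (ℕ.<-≤-trans (toℕ<n i) (ℕ.m≤n⇒m≤1+n n≤p-1))
                                              (ℕ.s≤s (ℕ.≤-trans (toℕ<n j) n≤p-1)))
        (det-onesExceptSubdiagonal m)
  where roots = everyResidueIsCube pr p%3≡2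
theorem3p3 p@(ℕ.suc _) pr _ p%3≡2 _ (inj₂ refl) n@(ℕ.suc (ℕ.suc m)) _ n≤p-1 =
  trans (det≡detℕ n _ onesExceptSuperdiagonal λ i j →
           entry-minus (toℕ i) (toℕ j) p roots (ℕ.s≤s (ℕ.≤-trans (toℕ<n i) n≤p-1))
                                               (ℕ.<-≤-trans (toℕ<n j) (ℕ.m≤n⇒m≤1+n n≤p-1)))
        (det-onesExceptSuperdiagonal m)
  where roots = everyResidueIsCube pr p%3≡2
theorem3p3 (ℕ.suc _) _ _ _ _ _ (ℕ.suc ℕ.zero) (ℕ.s≤s ())
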